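{- Let $\{A_n\}_{n\geq 1}$ be a family of nonempty sets with $A_n\subseteq\{0,1,\ldots,n-1\}$ for all $n$. Suppose the family satisfies: (C1) if $m\mid n$ and $a\in A_n$, then the remainder of $a$ upon division by $m$ lies in $A_m$; (C2) if $n=m_1m_2$ with $\gcd(m_1,m_2)=1$, $a_1\in A_{m_1}$, $a_2\in A_{m_2}$, and $a$ is the unique element of $\{0,\ldots,n-1\}$ with $a\equiv a_1\pmod{m_1}$ and $a\equiv a_2\pmod{m_2}$, then $a\in A_n$. Then the family $\{A_n\}_n$ is multiplicative.
   Context: For $m\mid n$, $A_n(m)=\{a+jm: a\in A_m,\ 0\leq j<n/m\}$. The family is multiplicative if whenever $n=m_1m_2$ with $\gcd(m_1,m_2)=1$, one has $A_n=A_n(m_1)\cap A_n(m_2)$. -}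

module Defs where

open import Data.Nat using (ℕ; suc; _+_; _*_; _<_; _≤_; NonZero)
open import Data.Nat.Divisibility using (_∣_)
open import Data.Nat.DivMod using (_/_; _%_)
open import Data.Nat.Coprimality using (Coprime)
open import Data.Product using (Σ; ∃; _×_)
open import Relation.Binary.PropositionalEquality using (_≡_)

-- A family {A_n}_{n ≥ 1} is given as a predicate  Fam n a  meaning  a ∈ A_n.
-- The index n is written as  suc k  where needed so that n ≥ 1.
Family : Set₁
Family = ℕ → ℕ → Set

Bounded : Family → Set
Bounded A = ∀ n a → 1 ≤ n → A n a → a < n

NonEmpty : Family → Set
NonEmpty A = ∀ n → 1 ≤ n → ∃ λ a → A n a

C1 : Family → Set
C1 A = ∀ m n a → .{{_ : NonZero m}} → .{{_ : NonZero n}} →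
       m ∣ n → A n a → A m (a % m)

C2 : Family → Set
C2 A = ∀ m₁ m₂ a₁ a₂ a → .{{_ : NonZero m₁}} → .{{_ : NonZero m₂}} →
       Coprime m₁ m₂ → A m₁ a₁ → A m₂ a₂ →
       a < m₁ * m₂ → a % m₁ ≡ a₁ % m₁ → a % m₂ ≡ a₂ % m₂ →
       A (m₁ * m₂) a

-- A_n(m) = { a + j m : a ∈ A_m, 0 ≤ j < n/m }   (for m ∣ n)
Lift : Family → (n m : ℕ) → .{{_ : NonZero m}} → ℕ → Set
Lift A n m x = Σ ℕ λ a → Σ ℕ λ j → A m a × j < n / m × x ≡ a + j * m

Multiplicative : Family → Set
Multiplicative A = ∀ m₁ m₂ → .{{_ : NonZero m₁}} → .{{_ : NonZero m₂}} →
  Coprime m₁ m₂ → ∀ x →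
  (A (m₁ * m₂) x → Lift A (m₁ * m₂) m₁ x × Lift A (m₁ * m₂) m₂ x) ×
  (Lift A (m₁ * m₂) m₁ x × Lift A (m₁ * m₂) m₂ x → A (m₁ * m₂) x)

module Submission where

-- Fix a divisor m of n.  An element x of A_n(m) is, by definition,
-- a number x = a + j·m with a ∈ A_m and j < n/m; read backwards, every x < n
-- has exactly this shape with a = x mod m and j = x div m.  Hence:
--   * if x ∈ A_n, then (C1) puts x mod m in A_m, and x < n gives x div m < n/m,
--     so x ∈ A_n(m)                                          (member⇒lift);
--   * if x ∈ A_n(m), then x < n and x ≡ a (mod m) for some a ∈ A_m
--                                                  (lift⇒below, lift⇒residue).  For n = m₁m₂ with m₁, m₂ coprime
-- the first gives A_n ⊆ A_n(m₁) ∩ A_n(m₂), and the second supplies exactly the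
-- data (C2) needs to conclude A_n(m₁) ∩ A_n(m₂) ⊆ A_n.

open import Defs
open import Data.Nat using (ℕ; _+_; _*_; _<_; NonZero; >-nonZero⁻¹)
open import Data.Nat.Properties using (≤-trans; +-monoˡ-<; *-monoˡ-≤; m*n≢0)
open import Data.Nat.DivMod using (_/_; _%_; m≡m%n+[m/n]*n; [m+kn]%n≡m%n; m/n*n≡m; m<n*o⇒m/o<n)
open import Data.Nat.Divisibility using (_∣_; m∣m*n; n∣m*n)
open import Data.Product using (Σ; _×_; _,_)
open import Relation.Binary.PropositionalEquality using (_≡_; refl; sym; subst)

quotient-bound : ∀ {m n x} .{{_ : NonZero m}} → m ∣ n → x < n → x / m < n / m
quotient-bound {m} {n} {x} m∣n x<n =
  m<n*o⇒m/o<n (subst (x <_) (sym (m/n*n≡m m∣n)) x<n)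

digits-bound : ∀ {m n a j} .{{_ : NonZero m}} → m ∣ n →
               a < m → j < n / m → a + j * m < n
digits-bound {m} {n} {a} {j} m∣n a<m j<n/m =
  subst (a + j * m <_) (m/n*n≡m m∣n)
    (≤-trans (+-monoˡ-< (j * m) a<m) (*-monoˡ-≤ m j<n/m))

member⇒lift : (A : Family) → Bounded A → C1 A →
              ∀ {m n x} .{{_ : NonZero m}} .{{_ : NonZero n}} →
              m ∣ n → A n x → Lift A n m x
member⇒lift A bounded c1 {m} {n} {x} m∣n x∈Aₙ =
  x % m , x / m , c1 m n x m∣n x∈Aₙ ,
  quotient-bound m∣n (bounded n x (>-nonZero⁻¹ n) x∈Aₙ) ,
  m≡m%n+[m/n]*n x m

lift⇒below : (A : Family) → Bounded A →
             ∀ {m n x} .{{_ : NonZero m}} → m ∣ n → Lift A n m x → x < n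
lift⇒below A bounded {m} m∣n (a , j , a∈Aₘ , j<n/m , refl) =
  digits-bound m∣n (bounded m a (>-nonZero⁻¹ m) a∈Aₘ) j<n/m

lift⇒residue : (A : Family) → ∀ {m n x} .{{_ : NonZero m}} →
               Lift A n m x → Σ ℕ λ a → A m a × x % m ≡ a % m
lift⇒residue A {m} (a , j , a∈Aₘ , _ , refl) = a , a∈Aₘ , [m+kn]%n≡m%n a j m

lemma2p2 : (A : Family) → NonEmpty A → Bounded A → C1 A → C2 A → Multiplicative A
lemma2p2 A _ bounded c1 c2 m₁ m₂ coprime x = member⇒both , both⇒member
  where
  instance
    n≢0 : NonZero (m₁ * m₂)
    n≢0 = m*n≢0 m₁ m₂

  m₁∣n : m₁ ∣ m₁ * m₂
  m₁∣n = m∣m*n m₂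

  m₂∣n : m₂ ∣ m₁ * m₂
  m₂∣n = n∣m*n m₁

  member⇒both : A (m₁ * m₂) x → Lift A (m₁ * m₂) m₁ x × Lift A (m₁ * m₂) m₂ x
  member⇒both x∈Aₙ = member⇒lift A bounded c1 m₁∣n x∈Aₙ
                   , member⇒lift A bounded c1 m₂∣n x∈Aₙ

  -- x itself is the CRT solution for its residues a₁ ∈ A_{m₁}, a₂ ∈ A_{m₂}.
  both⇒member : Lift A (m₁ * m₂) m₁ x × Lift A (m₁ * m₂) m₂ x → A (m₁ * m₂) x
  both⇒member (x∈lift₁ , x∈lift₂)
    with lift⇒residue A x∈lift₁ | lift⇒residue A x∈lift₂
  ... | a₁ , a₁∈A , x≡a₁ | a₂ , a₂∈A , x≡a₂ =
    c2 m₁ m₂ a₁ a₂ x coprime a₁∈A a₂∈A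
       (lift⇒below A bounded m₁∣n x∈lift₁) x≡a₁ x≡a₂
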